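{- Let $p\ge2$, $n\ge 6p-3$, and let $F\subseteq\{0,1,\dots,n-1\}$ be a facet of $\Delta_3(C_n^p)$ with $F\in\mathcal{A}_i$ for some $i\in\{1,\dots,n-2\}$, and write the complement as $F^c=\{\omega_i, i_1, i_2\}$ with $i_1<i_2$. If $i_1<i_2<\omega_i$ and $i_1\ge 2\mathbf{c}-\omega_i-p$, then $i_2\le \omega_i-p-1$.
   Context: $C_n^p$ is the graph on vertex set $\{0,1,\dots,n-1\}$ in which $u$ and $v$ are adjacent iff $v\equiv u\pm j \pmod n$ for some $j\in\{1,\dots,p\}$. A facet of the $3$-cut complex $\Delta_3(C_n^p)$ is a subset $F$ of the vertex set with $|F|=n-3$ such that the induced subgraph of $C_n^p$ on the complement $F^c$ is disconnected. Let $\mathbf{c}=\frac{n+1}{2}$ if $n$ is odd and $\mathbf{c}=\frac n2$ if $n$ is even. For $i\in\{1,\dots,n\}$ define $\omega_i = \mathbf{c}+(-1)^{i-1}\lfloor i/2\rfloor \pmod n$ (so $(\omega_1,\omega_2,\omega_3,\dots)=(\mathbf{c},\mathbf{c}-1,\mathbf{c}+1,\mathbf{c}-2,\dots)$, an enumeration of all vertices). For a subset $A$ of the vertex set with $|A|=n-3$, $A\in\mathcal{A}_i$ means $\omega_i\notin A$ and $\omega_1,\dots,\omega_{i-1}\in A$. All inequalities between vertices are inequalities between the integers $0,\dots,n-1$. -}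

module Defs where

open import Data.Nat using (ℕ; zero; suc; _+_; _*_; _∸_; _≤_; _<_; NonZero)
open import Data.Nat.DivMod using (_/_; _%_; _mod_)
open import Data.Bool using (if_then_else_)
open import Data.Nat using (_≡ᵇ_)
open import Data.Fin using (Fin; toℕ)
open import Data.Fin.Subset using (Subset; _∈_; _∉_; ∁; ∣_∣)
open import Data.Product using (Σ; ∃; _×_)
open import Data.Sum using (_⊎_)
open import Relation.Binary.PropositionalEquality using (_≡_; _≢_)
open import Relation.Nullary using (¬_)
open import Function.Bundles using (_⇔_)

Adj : (n p : ℕ) .{{_ : NonZero n}} → Fin n → Fin n → Set
Adj n p u v = (u ≢ v) × ∃ λ j → (1 ≤ j) × (j ≤ p) ×
  (((toℕ u + j) % n ≡ toℕ v) ⊎ ((toℕ v + j) % n ≡ toℕ u))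

InducedDisconnected : (n p : ℕ) .{{_ : NonZero n}} → Subset n → Set
InducedDisconnected n p S = Σ (Subset n) λ A → Σ (Subset n) λ B →
  (∀ v → (v ∈ S) ⇔ ((v ∈ A) ⊎ (v ∈ B))) ×
  (∀ v → ¬ ((v ∈ A) × (v ∈ B))) ×
  (∃ λ a → a ∈ A) × (∃ λ b → b ∈ B) ×
  (∀ a b → a ∈ A → b ∈ B → ¬ Adj n p a b)

IsFacet3 : (n p : ℕ) .{{_ : NonZero n}} → Subset n → Set
IsFacet3 n p F = (∣ F ∣ ≡ n ∸ 3) × InducedDisconnected n p (∁ F)

cc : ℕ → ℕ
cc n = if (n % 2) ≡ᵇ 0 then n / 2 else (n + 1) / 2

-- ω_i = c + (-1)^(i-1) ⌊i/2⌋ (mod n), as a natural number in {0,…,n-1},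
-- for 1 ≤ i ≤ n (for even i, c - ⌊i/2⌋ ≡ c + n - ⌊i/2⌋ mod n, and ⌊i/2⌋ ≤ n).
ω : (n : ℕ) .{{_ : NonZero n}} → ℕ → Fin n
ω n i = (if (i % 2) ≡ᵇ 1 then cc n + i / 2 else cc n + n ∸ i / 2) mod n

InA : (n : ℕ) .{{_ : NonZero n}} → ℕ → Subset n → Set
InA n i F = (ω n i ∉ F) × (∀ j → 1 ≤ j → j < i → ω n j ∈ F)

-- If ω_i ≤ i₂ + p then i₂ is adjacent to ω_i.  Also i₁ is adjacent to i₂: otherwise
-- i₂ + ω_i > i₁ + p + ω_i ≥ 2c, but every vertex b < ω_i with b + ω_i > 2c is some ω_j with
-- j < i, hence lies in F.  So Fᶜ = {i₁, i₂, ω_i} would carry the path i₁ — i₂ — ω_i and be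
-- connected.
module Submission where

open import Defs
open import Data.Nat using (ℕ; _+_; _*_; _∸_; _≤_; _<_; NonZero)
open import Data.Fin using (Fin; toℕ)
open import Data.Fin.Subset using (Subset; _∈_; ∁)
open import Relation.Binary.PropositionalEquality using (_≢_)

open import Data.Bool using (true; false; if_then_else_)
open import Data.Empty using (⊥; ⊥-elim)
open import Data.Fin using (_≟_)
open import Data.Fin.Properties using (toℕ-injective; toℕ<n; toℕ-fromℕ<)
open import Data.Fin.Subset using (∣_∣; _-_)
open import Data.Fin.Subset.Properties
  using (x∈p⇒∣p-x∣<∣p∣; x∈p∧x≢y⇒x∈p-y; x∈∁p⇒x∉p; x∉p⇒x∈∁p; ∣∁p∣≡n∸∣p∣)
open import Data.Nat using (zero; suc; z≤n; s≤s; _≡ᵇ_; _≤?_)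
open import Data.Nat.DivMod
open import Data.Nat.Divisibility using (n∣m*n)
open import Data.Nat.Properties hiding (_≟_)
open import Algebra.Properties.CommutativeSemigroup +-commutativeSemigroup
  using (x∙yz≈y∙xz; xy∙z≈xz∙y)
open import Data.Product using (_,_; _×_; ∃; proj₁)
open import Data.Sum using (_⊎_; inj₁; inj₂)
import Data.Sum as ⊎
open import Function.Base using (_∘_)
open import Function.Bundles using (Equivalence; _⇔_; mk⇔)
open import Relation.Binary.PropositionalEquality
  using (_≡_; refl; sym; trans; cong; subst; ≢-sym; module ≡-Reasoning)
open import Relation.Nullary using (¬_; yes; no; contradiction)

private
  variable
    n p : ℕ

Adj-sym : .{{_ : NonZero n}} {u v : Fin n} → Adj n p u v → Adj n p v u
Adj-sym (u≢v , j , 1≤j , j≤p , v≡u±j) = ≢-sym u≢v , j , 1≤j , j≤p , ⊎.swap v≡u±j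

Adj-within : .{{_ : NonZero n}} (u v : Fin n) →
  toℕ u < toℕ v → toℕ v ≤ toℕ u + p → Adj n p u v
Adj-within {n} {p} u v u<v v≤u+p =
  (λ u≡v → <-irrefl (cong toℕ u≡v) u<v) , toℕ v ∸ toℕ u , m<n⇒0<n∸m u<v ,
  ≤-trans (∸-monoˡ-≤ (toℕ u) v≤u+p) (≤-reflexive (m+n∸m≡n (toℕ u) p)) ,
  inj₁ (trans (cong (_% n) (m+[n∸m]≡n (<⇒≤ u<v))) (m<n⇒m%n≡m (toℕ<n v)))

x∈p∧k≤∣p-x∣⇒k<∣p∣ : ∀ {k} {S : Subset n} {x} → x ∈ S → k ≤ ∣ S - x ∣ → k < ∣ S ∣
x∈p∧k≤∣p-x∣⇒k<∣p∣ x∈S k≤ = ≤-<-trans k≤ (x∈p⇒∣p-x∣<∣p∣ x∈S)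

four-distinct⇒4≤∣p∣ : ∀ {S : Subset n} {w x y z} →
  w ∈ S → x ∈ S → y ∈ S → z ∈ S →
  w ≢ x → w ≢ y → w ≢ z → x ≢ y → x ≢ z → y ≢ z → 4 ≤ ∣ S ∣
four-distinct⇒4≤∣p∣ {S = S} {w} {x} {y} {z} w∈ x∈ y∈ z∈ w≢x w≢y w≢z x≢y x≢z y≢z =
  x∈p∧k≤∣p-x∣⇒k<∣p∣ w∈ (x∈p∧k≤∣p-x∣⇒k<∣p∣ x∈S-w
    (x∈p∧k≤∣p-x∣⇒k<∣p∣ y∈S-w-x (x∈p∧k≤∣p-x∣⇒k<∣p∣ z∈S-w-x-y z≤n)))
  where
  x∈S-w : x ∈ S - w
  x∈S-w = x∈p∧x≢y⇒x∈p-y x∈ (≢-sym w≢x)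
  y∈S-w-x : y ∈ S - w - x
  y∈S-w-x = x∈p∧x≢y⇒x∈p-y (x∈p∧x≢y⇒x∈p-y y∈ (≢-sym w≢y)) (≢-sym x≢y)
  z∈S-w-x-y : z ∈ S - w - x - y
  z∈S-w-x-y = x∈p∧x≢y⇒x∈p-y
    (x∈p∧x≢y⇒x∈p-y (x∈p∧x≢y⇒x∈p-y z∈ (≢-sym w≢z)) (≢-sym x≢z)) (≢-sym y≢z)

∣p∣≡3⇒distinct-members-exhaust : ∀ {S : Subset n} {x y z v} → ∣ S ∣ ≡ 3 →
  x ∈ S → y ∈ S → z ∈ S → x ≢ y → x ≢ z → y ≢ z →
  v ∈ S → v ≡ x ⊎ v ≡ y ⊎ v ≡ z
∣p∣≡3⇒distinct-members-exhaust {x = x} {y} {z} {v} ∣S∣≡3 x∈ y∈ z∈ x≢y x≢z y≢z v∈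
  with v ≟ x | v ≟ y | v ≟ z
... | yes v≡x | _ | _ = inj₁ v≡x
... | no _ | yes v≡y | _ = inj₂ (inj₁ v≡y)
... | no _ | no _ | yes v≡z = inj₂ (inj₂ v≡z)
... | no v≢x | no v≢y | no v≢z = contradiction
  (subst (4 ≤_) ∣S∣≡3
    (four-distinct⇒4≤∣p∣ x∈ y∈ z∈ v∈ x≢y x≢z (≢-sym v≢x) y≢z (≢-sym v≢y) (≢-sym v≢z)))
  (n≮n 3)

∣p∣≡n∸3⇒∣∁p∣≡3 : {S : Subset n} → 3 ≤ n → ∣ S ∣ ≡ n ∸ 3 → ∣ ∁ S ∣ ≡ 3
∣p∣≡n∸3⇒∣∁p∣≡3 {n} {S} 3≤n ∣S∣≡n∸3 = begin
  ∣ ∁ S ∣     ≡⟨ ∣∁p∣≡n∸∣p∣ S ⟩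
  n ∸ ∣ S ∣   ≡⟨ cong (n ∸_) ∣S∣≡n∸3 ⟩
  n ∸ (n ∸ 3) ≡⟨ m∸[m∸n]≡n 3≤n ⟩
  3           ∎
  where open ≡-Reasoning

module _ {n p : ℕ} .{{_ : NonZero n}} {S : Subset n} where

  swap-sides : InducedDisconnected n p S → InducedDisconnected n p S
  swap-sides (A , B , cover , disjoint , a∈A , b∈B , noEdge) =
    B , A , (λ v → ⊎-swap-⇔ (cover v)) , (λ v (v∈B , v∈A) → disjoint v (v∈A , v∈B)) ,
    b∈B , a∈A , λ b a b∈B a∈A b~a → noEdge a b a∈A b∈B (Adj-sym b~a)
    where
    ⊎-swap-⇔ : ∀ {P Q R : Set} → P ⇔ (Q ⊎ R) → P ⇔ (R ⊎ Q)
    ⊎-swap-⇔ P⇔Q⊎R = mk⇔ (⊎.swap ∘ to P⇔Q⊎R) (from P⇔Q⊎R ∘ ⊎.swap)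
      where open Equivalence

  first-side-absorbs-path : ∀ {x y z} (D : InducedDisconnected n p S) →
    (∀ v → v ∈ S → v ≡ x ⊎ v ≡ y ⊎ v ≡ z) → x ∈ S → z ∈ S →
    Adj n p y x → Adj n p y z → y ∈ proj₁ D → ⊥
  first-side-absorbs-path {x} {y} {z} (A , B , cover , disjoint , _ , (b , b∈B) , noEdge)
    members x∈S z∈S y~x y~z y∈A = disjoint b (absorbed b (from (cover b) (inj₂ b∈B)) , b∈B)
    where
    open Equivalence
    neighbour∈A : ∀ {u v} → u ∈ A → v ∈ S → Adj n p u v → v ∈ A
    neighbour∈A {u} {v} u∈A v∈S u~v =
      ⊎.[ (λ v∈A → v∈A) , (λ v∈B → ⊥-elim (noEdge u v u∈A v∈B u~v)) ]′ (to (cover v) v∈S)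
    absorbed : ∀ v → v ∈ S → v ∈ A
    absorbed v v∈S with members v v∈S
    ... | inj₁ refl = neighbour∈A y∈A x∈S y~x
    ... | inj₂ (inj₁ refl) = y∈A
    ... | inj₂ (inj₂ refl) = neighbour∈A y∈A z∈S y~z

  path-connected : ∀ {x y z} → ∣ S ∣ ≡ 3 →
    x ∈ S → y ∈ S → z ∈ S → x ≢ y → x ≢ z → y ≢ z →
    Adj n p x y → Adj n p y z → ¬ InducedDisconnected n p S
  path-connected {y = y} ∣S∣≡3 x∈ y∈ z∈ x≢y x≢z y≢z x~y y~z D@(_ , _ , cover , _) =
    ⊎.[ absorbed-by D , absorbed-by (swap-sides D) ]′ (Equivalence.to (cover y) y∈)
    where
    members : ∀ v → v ∈ S → v ≡ _ ⊎ v ≡ y ⊎ v ≡ _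
    members = λ v → ∣p∣≡3⇒distinct-members-exhaust {v = v} ∣S∣≡3 x∈ y∈ z∈ x≢y x≢z y≢z
    absorbed-by : (D′ : InducedDisconnected n p S) → y ∈ proj₁ D′ → ⊥
    absorbed-by D′ = first-side-absorbs-path D′ members x∈ z∈ (Adj-sym x~y) y~z

data Parity : ℕ → Set where
  even : ∀ h → Parity (h * 2)
  odd  : ∀ h → Parity (1 + h * 2)

parity : ∀ i → Parity i
parity zero = even 0
parity (suc i) with parity i
... | even h = odd h
... | odd h = even (suc h)

[1+h*2]/2≡h : ∀ h → (1 + h * 2) / 2 ≡ h
[1+h*2]/2≡h h = trans (+-distrib-/-∣ʳ 1 {d = 2} (n∣m*n h)) (m*n/n≡m h 2)

[1+h*2]%2≡1 : ∀ h → (1 + h * 2) % 2 ≡ 1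
[1+h*2]%2≡1 h = [m+kn]%n≡m%n 1 h 2

[h*2]%2≡0 : ∀ h → (h * 2) % 2 ≡ 0
[h*2]%2≡0 h = m*n%n≡0 h 2

[h*2]/2≡h : ∀ h → (h * 2) / 2 ≡ h
[h*2]/2≡h h = m*n/n≡m h 2

m+m≡2*m : ∀ m → m + m ≡ 2 * m
m+m≡2*m m = cong (m +_) (sym (+-identityʳ m))

n/2≤cc : ∀ n → n / 2 ≤ cc n
n/2≤cc n with (n % 2) ≡ᵇ 0
... | true = ≤-refl
... | false = /-monoˡ-≤ 2 (m≤m+n n 1)

module _ (n : ℕ) .{{_ : NonZero n}} where

  toℕ-ω : ∀ i →
    toℕ (ω n i) ≡ (if (i % 2) ≡ᵇ 1 then cc n + i / 2 else cc n + n ∸ i / 2) % n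
  toℕ-ω i = toℕ-fromℕ< _

  toℕ-ω-odd : ∀ h → toℕ (ω n (1 + h * 2)) ≡ (cc n + h) % n
  toℕ-ω-odd h rewrite toℕ-ω (1 + h * 2) | [1+h*2]%2≡1 h | [1+h*2]/2≡h h = refl

  toℕ-ω-even : ∀ h → h ≤ cc n → toℕ (ω n (h * 2)) ≡ (cc n ∸ h) % n
  toℕ-ω-even h h≤c
    rewrite toℕ-ω (h * 2) | [h*2]%2≡0 h | [h*2]/2≡h h | +-∸-comm n h≤c =
    [m+n]%n≡m%n (cc n ∸ h) n

  %n≡toℕ : ∀ {m} (b : Fin n) → m ≡ toℕ b → m % n ≡ toℕ b
  %n≡toℕ b refl = m<n⇒m%n≡m (toℕ<n b)

  ω-odd≤c+h : ∀ h → toℕ (ω n (1 + h * 2)) ≤ cc n + h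
  ω-odd≤c+h h = ≤-trans (≤-reflexive (toℕ-ω-odd h)) (m%n≤m (cc n + h) n)

  ω-even≤c : ∀ h → h * 2 ≤ n → toℕ (ω n (h * 2)) ≤ cc n
  ω-even≤c h h*2≤n =
    ≤-trans (≤-reflexive (toℕ-ω-even h h≤c)) (≤-trans (m%n≤m _ n) (m∸n≤m (cc n) h))
    where
    h≤c : h ≤ cc n
    h≤c = ≤-trans (subst (_≤ n / 2) ([h*2]/2≡h h) (/-monoˡ-≤ 2 h*2≤n)) (n/2≤cc n)

  ω-odd-enumerates-above-c : ∀ h (b : Fin n) →
    cc n ≤ toℕ b → toℕ b < toℕ (ω n (1 + h * 2)) →
    ∃ λ e → e < h × ω n (1 + e * 2) ≡ b
  ω-odd-enumerates-above-c h b c≤b b<ω =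
    e , e<h , toℕ-injective (trans (toℕ-ω-odd e) (%n≡toℕ b c+e≡b))
    where
    e : ℕ
    e = toℕ b ∸ cc n
    c+e≡b : cc n + e ≡ toℕ b
    c+e≡b = m+[n∸m]≡n c≤b
    e<h : e < h
    e<h = +-cancelˡ-< (cc n) e h
      (subst (_< cc n + h) (sym c+e≡b) (<-≤-trans b<ω (ω-odd≤c+h h)))

  ω-even-enumerates-below-c : ∀ h (b : Fin n) →
    toℕ b < cc n → 2 * cc n < toℕ b + toℕ (ω n (1 + h * 2)) →
    ∃ λ e → 1 ≤ e × e < h × ω n (e * 2) ≡ b
  ω-even-enumerates-below-c h b b<c outside =
    e , m<n⇒0<n∸m b<c , e<h ,
    toℕ-injective (trans (toℕ-ω-even e (m∸n≤m (cc n) (toℕ b)))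
                         (%n≡toℕ b (m∸[m∸n]≡n (<⇒≤ b<c))))
    where
    e : ℕ
    e = cc n ∸ toℕ b
    b+e≡c : toℕ b + e ≡ cc n
    b+e≡c = m+[n∸m]≡n (<⇒≤ b<c)
    c+c<c+[b+h] : cc n + cc n < cc n + (toℕ b + h)
    c+c<c+[b+h] = begin-strict
      cc n + cc n                   ≡⟨ m+m≡2*m (cc n) ⟩
      2 * cc n                      <⟨ outside ⟩
      toℕ b + toℕ (ω n (1 + h * 2)) ≤⟨ +-monoʳ-≤ (toℕ b) (ω-odd≤c+h h) ⟩
      toℕ b + (cc n + h)            ≡⟨ x∙yz≈y∙xz (toℕ b) (cc n) h ⟩
      cc n + (toℕ b + h)            ∎
      where open ≤-Reasoning
    e<h : e < h
    e<h = +-cancelˡ-< (toℕ b) e h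
      (subst (_< toℕ b + h) (sym b+e≡c) (+-cancelˡ-< (cc n) (cc n) _ c+c<c+[b+h]))

  -- ω_{2h+1} = c + h and ω_{2h} = c − h: the enumeration sweeps outwards from c.
  ω-enumerates-centre : ∀ i → i ≤ n → (b : Fin n) →
    toℕ b < toℕ (ω n i) → 2 * cc n < toℕ b + toℕ (ω n i) →
    ∃ λ j → 1 ≤ j × j < i × ω n j ≡ b
  ω-enumerates-centre i i≤n b b<ω outside with parity i
  ... | even h = contradiction outside (≤⇒≯ (begin
    toℕ b + toℕ (ω n (h * 2)) ≤⟨ +-mono-≤ (<⇒≤ (<-≤-trans b<ω ω≤c)) ω≤c ⟩
    cc n + cc n               ≡⟨ m+m≡2*m (cc n) ⟩
    2 * cc n                  ∎))
    where
    open ≤-Reasoning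
    ω≤c : toℕ (ω n (h * 2)) ≤ cc n
    ω≤c = ω-even≤c h i≤n
  ... | odd h with cc n ≤? toℕ b
  ...   | yes c≤b =
    let (e , e<h , ωj≡b) = ω-odd-enumerates-above-c h b c≤b b<ω
    in 1 + e * 2 , s≤s z≤n , s≤s (*-monoˡ-< 2 e<h) , ωj≡b
  ...   | no c≰b =
    let (e , 1≤e , e<h , ωj≡b) = ω-even-enumerates-below-c h b (≰⇒> c≰b) outside
    in e * 2 , ≤-trans 1≤e (m≤m*n e 2) , m<n⇒m<1+n (*-monoˡ-< 2 e<h) , ωj≡b

∁-below-ω-near-centre : .{{_ : NonZero n}} {F : Subset n} {i : ℕ} → i ≤ n → InA n i F →
  {b : Fin n} → b ∈ ∁ F → toℕ b < toℕ (ω n i) → toℕ b + toℕ (ω n i) ≤ 2 * cc n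
∁-below-ω-near-centre {n} {F} {i} i≤n (_ , earlier∈F) {b} b∈∁F b<ω = ≮⇒≥ λ outside →
  let (j , 1≤j , j<i , ωj≡b) = ω-enumerates-centre n i i≤n b b<ω outside
  in x∈∁p⇒x∉p b∈∁F (subst (_∈ F) ωj≡b (earlier∈F j 1≤j j<i))

proposition3p5 : (p n : ℕ) .{{_ : NonZero n}} → 2 ≤ p → 6 * p ∸ 3 ≤ n →
    (F : Subset n) → IsFacet3 n p F →
    (i : ℕ) → 1 ≤ i → i ≤ n ∸ 2 → InA n i F →
    (i₁ i₂ : Fin n) → i₁ ∈ ∁ F → i₂ ∈ ∁ F → i₁ ≢ ω n i → i₂ ≢ ω n i →
    toℕ i₁ < toℕ i₂ → toℕ i₂ < toℕ (ω n i) →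
    2 * cc n ≤ toℕ i₁ + toℕ (ω n i) + p →
    toℕ i₂ + p + 1 ≤ toℕ (ω n i)
proposition3p5 p n 2≤p 6p∸3≤n F (∣F∣≡n∸3 , disconnected) i _ i≤n∸2 i∈A
  i₁ i₂ i₁∈∁F i₂∈∁F i₁≢ω i₂≢ω i₁<i₂ i₂<ω 2c≤i₁+ω+p
  with toℕ (ω n i) ≤? toℕ i₂ + p
... | no ω≰i₂+p = subst (_≤ toℕ (ω n i)) (+-comm 1 (toℕ i₂ + p)) (≰⇒> ω≰i₂+p)
... | yes ω≤i₂+p = contradiction disconnected
  (path-connected (∣p∣≡n∸3⇒∣∁p∣≡3 {S = F} 3≤n ∣F∣≡n∸3)
    i₁∈∁F i₂∈∁F (x∉p⇒x∈∁p (proj₁ i∈A)) i₁≢i₂ i₁≢ω i₂≢ω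
    (Adj-within i₁ i₂ i₁<i₂ i₂≤i₁+p) (Adj-within i₂ (ω n i) i₂<ω ω≤i₂+p))
  where
  3≤n : 3 ≤ n
  3≤n = ≤-trans (m≤m+n 3 6) (≤-trans (∸-monoˡ-≤ 3 (*-monoʳ-≤ 6 2≤p)) 6p∸3≤n)
  i₁≢i₂ : i₁ ≢ i₂
  i₁≢i₂ i₁≡i₂ = <-irrefl (cong toℕ i₁≡i₂) i₁<i₂
  i₂≤i₁+p : toℕ i₂ ≤ toℕ i₁ + p
  i₂≤i₁+p = +-cancelʳ-≤ (toℕ (ω n i)) (toℕ i₂) (toℕ i₁ + p) (begin
    toℕ i₂ + toℕ (ω n i)     ≤⟨ ∁-below-ω-near-centre (≤-trans i≤n∸2 (m∸n≤m n 2)) i∈A i₂∈∁F i₂<ω ⟩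
    2 * cc n                 ≤⟨ 2c≤i₁+ω+p ⟩
    toℕ i₁ + toℕ (ω n i) + p ≡⟨ xy∙z≈xz∙y (toℕ i₁) (toℕ (ω n i)) p ⟩
    toℕ i₁ + p + toℕ (ω n i) ∎)
    where open ≤-Reasoning
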